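{- Let $G$ be a connected cograph with at least two vertices. Let $k$ be the number of nontrivial connected components of $\overline{G}$ and $t$ the number of trivial connected components of $\overline{G}$. Then: (i) if $k = 0$, then $h(G\overline{G}) = t$; (ii) if $k = 1$, letting $\overline{G}_1$ be the nontrivial component of $\overline{G}$ and $G_1$ the subgraph of $G$ induced by the vertices corresponding to $V(\overline{G}_1)$, we have $t+2 \leq h(G\overline{G}) \leq \min\{h(G_1), h(\overline{G}_1)\} + t$; (iii) if $k \geq 2$, then $h(G\overline{G}) = k + t + 1$.
   Context: All graphs are finite, simple and undirected. A cograph is a graph with no induced path on four vertices. For a graph $H$ and $x,y \in V(H)$, the closed interval $I[x,y]$ consists of $x$, $y$ and all vertices lying on some shortest path between $x$ and $y$ in $H$; for $S \subseteq V(H)$, $I[S] = \bigcup_{x,y\in S} I[x,y]$. A set $S$ is (geodetically) convex if $I[S]=S$; the convex hull $H(S)$ is the smallest convex set containing $S$; $S$ is a hull set if $H(S)=V(H)$; the (geodetic) hull number $h(H)$ is the minimum cardinality of a hull set of $H$ (hull numbers of $G_1$, $\overline{G}_1$ are taken in those graphs on their own). For a graph $G$ with vertex set $\{v_1,\dots,v_n\}$, the complementary prism $G\overline{G}$ has vertex set $\{v_1,\dots,v_n\}\cup\{\overline{v}_1,\dots,\overline{v}_n\}$ and edge set $E(G) \cup \{\overline{v}_i\overline{v}_j : i<j,\ v_iv_j\notin E(G)\} \cup \{v_i\overline{v}_i : 1\le i\le n\}$; $v_i$ and $\overline{v}_i$ are corresponding vertices. A component is trivial if it has exactly one vertex, nontrivial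 otherwise. -}

module Defs where

open import Data.Nat using (ℕ; zero; suc; _+_; _≤_)
open import Data.Fin using (Fin; _≟_; splitAt)
open import Data.Fin.Subset using (Subset; _∈_; _⊆_; ∣_∣)
open import Data.Bool using (Bool; true; false; not; if_then_else_)
open import Data.Sum using (_⊎_; inj₁; inj₂)
open import Data.Product using (Σ; _×_; _,_; ∃)
open import Data.Empty using (⊥-elim)
open import Relation.Nullary using (¬_; yes; no; does)
open import Relation.Binary.PropositionalEquality using (_≡_; _≢_; refl; sym; cong)

record Graph (n : ℕ) : Set where
  field
    adj    : Fin n → Fin n → Bool
    adj-sym    : ∀ u v → adj u v ≡ adj v u
    adj-irrefl : ∀ u → adj u u ≡ false
open Graph public

Edge : ∀ {n} → Graph n → Fin n → Fin n → Set
Edge G u v = adj G u v ≡ true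

private
  does-sym : ∀ {n} (u v : Fin n) → does (u ≟ v) ≡ does (v ≟ u)
  does-sym u v with u ≟ v | v ≟ u
  ... | yes _ | yes _ = refl
  ... | yes p | no q = ⊥-elim (q (sym p))
  ... | no q | yes p = ⊥-elim (q (sym p))
  ... | no _ | no _ = refl

  cadj : ∀ {n} → Graph n → Fin n → Fin n → Bool
  cadj G u v = if does (u ≟ v) then false else not (adj G u v)

  cadj-sym : ∀ {n} (G : Graph n) u v → cadj G u v ≡ cadj G v u
  cadj-sym G u v with u ≟ v | v ≟ u
  ... | yes _ | yes _ = refl
  ... | yes p | no q = ⊥-elim (q (sym p))
  ... | no q | yes p = ⊥-elim (q (sym p))
  ... | no _ | no _ = cong not (adj-sym G u v)

  cadj-irrefl : ∀ {n} (G : Graph n) u → cadj G u u ≡ false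
  cadj-irrefl G u with u ≟ u
  ... | yes _ = refl
  ... | no q = ⊥-elim (q refl)

complement : ∀ {n} → Graph n → Graph n
complement G = record { adj = cadj G ; adj-sym = cadj-sym G ; adj-irrefl = cadj-irrefl G }

-- The subgraph induced by the image of an (injective) map ι : Fin m → Fin n,
-- relabelled on vertex set Fin m.
induced : ∀ {m n} → Graph n → (Fin m → Fin n) → Graph m
induced G ι = record
  { adj = λ i j → adj G (ι i) (ι j)
  ; adj-sym = λ i j → adj-sym G (ι i) (ι j)
  ; adj-irrefl = λ i → adj-irrefl G (ι i) }

private
  padj : ∀ {n} → Graph n → Fin n ⊎ Fin n → Fin n ⊎ Fin n → Bool
  padj G (inj₁ i) (inj₁ j) = adj G i j
  padj G (inj₂ i) (inj₂ j) = adj (complement G) i j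
  padj G (inj₁ i) (inj₂ j) = does (i ≟ j)
  padj G (inj₂ i) (inj₁ j) = does (i ≟ j)

  padj-sym : ∀ {n} (G : Graph n) u v → padj G u v ≡ padj G v u
  padj-sym G (inj₁ i) (inj₁ j) = adj-sym G i j
  padj-sym G (inj₂ i) (inj₂ j) = adj-sym (complement G) i j
  padj-sym G (inj₁ i) (inj₂ j) = does-sym i j
  padj-sym G (inj₂ i) (inj₁ j) = does-sym i j

  padj-irrefl : ∀ {n} (G : Graph n) u → padj G u u ≡ false
  padj-irrefl G (inj₁ i) = adj-irrefl G i
  padj-irrefl G (inj₂ i) = adj-irrefl (complement G) i

-- The complementary prism G Ḡ on Fin (n + n): vertex v_i is the i-th vertex
-- of the first block (copy of G), v̄_i the i-th vertex of the second block
-- (copy of Ḡ); v_i v̄_i are the matching edges.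
prism : ∀ {n} → Graph n → Graph (n + n)
prism {n} G = record
  { adj = λ u v → padj G (splitAt n u) (splitAt n v)
  ; adj-sym = λ u v → padj-sym G (splitAt n u) (splitAt n v)
  ; adj-irrefl = λ u → padj-irrefl G (splitAt n u) }

data Walk {n} (G : Graph n) : Fin n → Fin n → ℕ → Set where
  nil  : ∀ {u} → Walk G u u 0
  cons : ∀ {u w v ℓ} → Edge G u w → Walk G w v ℓ → Walk G u v (suc ℓ)

Reach : ∀ {n} → Graph n → Fin n → Fin n → Set
Reach G u v = ∃ λ ℓ → Walk G u v ℓ

Connected : ∀ {n} → Graph n → Set
Connected G = ∀ u v → Reach G u v

-- No induced path a-b-c-d on four vertices (distinctness is forced by the
-- edge/non-edge pattern).
Cograph : ∀ {n} → Graph n → Set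
Cograph G = ∀ a b c d →
  ¬ (Edge G a b × Edge G b c × Edge G c d ×
     ¬ Edge G a c × ¬ Edge G b d × ¬ Edge G a d)

TrivialAt : ∀ {n} → Graph n → Fin n → Set
TrivialAt G v = ∀ w → Reach G v w → w ≡ v

NonTrivialAt : ∀ {n} → Graph n → Fin n → Set
NonTrivialAt G v = Σ (Fin _) λ w → Reach G v w × w ≢ v

-- G has exactly c connected components whose vertices satisfy P
-- (P is a component-invariant property such as TrivialAt/NonTrivialAt):
-- there is a set R of representatives, one per such component.
NumComponents : ∀ {n} → (G : Graph n) → (Fin n → Set) → ℕ → Set
NumComponents {n} G P c = Σ (Subset n) λ R →
  ∣ R ∣ ≡ c ×
  (∀ r → r ∈ R → P r) ×
  (∀ v → P v → Σ (Fin n) λ r → r ∈ R × Reach G v r) ×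
  (∀ r r′ → r ∈ R → r′ ∈ R → Reach G r r′ → r ≡ r′)

-- z ∈ I[x,y]: z = x, z = y, or z lies on a shortest x–y path, i.e. there are
-- walks x ⇝ z and z ⇝ y whose total length is at most that of every x–y walk.
InInterval : ∀ {n} → Graph n → Fin n → Fin n → Fin n → Set
InInterval G x y z =
  z ≡ x ⊎ z ≡ y ⊎
  Σ ℕ λ a → Σ ℕ λ b → Walk G x z a × Walk G z y b ×
    (∀ m → Walk G x y m → a + b ≤ m)

Convex : ∀ {n} → Graph n → Subset n → Set
Convex G C = ∀ x y z → x ∈ C → y ∈ C → InInterval G x y z → z ∈ C

-- H(S) = V(G): the only convex set containing S is the whole vertex set.
IsHullSet : ∀ {n} → Graph n → Subset n → Set
IsHullSet G S = ∀ C → S ⊆ C → Convex G C → ∀ v → v ∈ C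

HullNumber : ∀ {n} → Graph n → ℕ → Set
HullNumber {n} G h =
  (Σ (Subset n) λ S → IsHullSet G S × ∣ S ∣ ≡ h) ×
  (∀ S → IsHullSet G S → h ≤ ∣ S ∣)

module Submission where

-- A connected cograph G on ≥ 2 vertices has a disconnected complement
-- (Seinsche), and components of cographs have diameter ≤ 2.  In the prism
-- GḠ, vertices v̄_u, v̄_v of different Ḡ-components are at distance 3 with v_u
-- on a geodesic between them; this drives the closure arguments below.
-- Lower bound: for every Ḡ-component C the set V(G) ∪ {v̄_u : u ∉ C} is convex,
-- so a hull set meets the Ḡ-copy of every component (h ≥ k + t); if Ḡ has an
-- edge, a second convex set forces one more vertex.  Upper bounds come from
-- explicit hull sets: the Ḡ-copy of a system of representatives (k = 0), plus
-- one v-vertex (k ≥ 2), and for k = 1 the image of a hull set of G₁ or Ḡ₁,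
-- transferred along the induced embedding, plus the isolated vertices of Ḡ.

open import Defs
open import Data.Nat using (ℕ; zero; suc; _+_; _≤_; _<_; _⊓_; z≤n; s≤s)
open import Data.Nat.Properties using (≤-refl; ≤-trans; <-≤-trans; <-irrefl; ≤-reflexive; +-suc; +-comm; +-identityʳ; +-mono-≤; +-monoʳ-≤; ⊓-glb; +-distribʳ-⊓)
import Data.Nat.Properties
open import Data.Fin using (Fin; zero; suc; _≟_; splitAt; _↑ˡ_; _↑ʳ_)
open import Data.Fin.Properties using (any?; all?; ¬∀⟶∃¬; suc-injective; 0≢1+n; splitAt-↑ˡ; splitAt-↑ʳ; splitAt⁻¹-↑ˡ; splitAt⁻¹-↑ʳ; ↑ˡ-injective; ↑ʳ-injective)
open import Data.Fin.Subset using (Subset; _∈_; _∉_; _⊆_; _⊂_; ∣_∣; ⊥; ⊤; ⁅_⁆; _∪_; _-_; inside; outside; Nonempty)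
open import Data.Fin.Subset.Properties using (_∈?_; ∈⊤; ∉⊥; x∈⁅x⁆; x∈p∪q⁺; x∈p∪q⁻; x∈p∧x≢y⇒x∈p-y; x∈p⇒∣p-x∣<∣p∣; p⊂q⇒∣p∣<∣q∣; p⊆q⇒∣p∣≤∣q∣; ∣p∣≤n; ∣p∣≤∣x∷p∣; ∣⊥∣≡0; ∣⁅x⁆∣≡1; nonempty?; Empty-unique)
open import Data.Vec using ([]; _∷_; _++_; tabulate; here; there)
open import Data.Vec.Properties using (lookup⇒[]=; []=⇒lookup; lookup∘tabulate)
open import Data.Bool using (true; false)
import Data.Bool as Bool
open import Data.Sum using (_⊎_; inj₁; inj₂)
open import Data.Product using (Σ; _×_; _,_; proj₁; proj₂)
open import Data.Empty using (⊥-elim)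
open import Function using (_∘_)
open import Function.Definitions using (Injective)
open import Relation.Nullary using (¬_; yes; no; does; Dec; ¬?; _×-dec_)
open import Relation.Unary using (Pred; Decidable)
open import Relation.Binary.PropositionalEquality using (_≡_; _≢_; refl; sym; trans; cong; cong₂; subst)

⟦_⟧ : ∀ {n p} {P : Pred (Fin n) p} → Decidable P → Subset n
⟦ P? ⟧ = tabulate (λ i → does (P? i))

∈⟦⟧⁺ : ∀ {n p} {P : Pred (Fin n) p} (P? : Decidable P) {i} → P i → i ∈ ⟦ P? ⟧
∈⟦⟧⁺ P? {i} Pi = lookup⇒[]= i _ (trans (lookup∘tabulate _ i) (holds (P? i)))
  where
  holds : (d : Dec _) → does d ≡ true
  holds (yes _) = refl
  holds (no ¬Pi) = ⊥-elim (¬Pi Pi)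

∈⟦⟧⁻ : ∀ {n p} {P : Pred (Fin n) p} (P? : Decidable P) {i} → i ∈ ⟦ P? ⟧ → P i
∈⟦⟧⁻ P? {i} i∈ = extract (P? i) (trans (sym (lookup∘tabulate _ i)) ([]=⇒lookup i∈))
  where
  extract : (d : Dec _) → does d ≡ true → _
  extract (yes Pi) _ = Pi
  extract (no _) ()

∣p++q∣≡∣p∣+∣q∣ : ∀ {m n} (p : Subset m) (q : Subset n) → ∣ p ++ q ∣ ≡ ∣ p ∣ + ∣ q ∣
∣p++q∣≡∣p∣+∣q∣ [] q = refl
∣p++q∣≡∣p∣+∣q∣ (inside ∷ p) q = cong suc (∣p++q∣≡∣p∣+∣q∣ p q)
∣p++q∣≡∣p∣+∣q∣ (outside ∷ p) q = ∣p++q∣≡∣p∣+∣q∣ p q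

∈-++ˡ⁺ : ∀ {m n} {p : Subset m} {i} (q : Subset n) → i ∈ p → i ↑ˡ n ∈ p ++ q
∈-++ˡ⁺ q here = here
∈-++ˡ⁺ q (there i∈p) = there (∈-++ˡ⁺ q i∈p)

∈-++ˡ⁻ : ∀ {m n} (p : Subset m) {q : Subset n} {i} → i ↑ˡ n ∈ p ++ q → i ∈ p
∈-++ˡ⁻ (_ ∷ p) {i = zero} here = here
∈-++ˡ⁻ (_ ∷ p) {i = suc i} (there i∈) = there (∈-++ˡ⁻ p i∈)

∈-++ʳ⁺ : ∀ {m n} (p : Subset m) {q : Subset n} {i} → i ∈ q → m ↑ʳ i ∈ p ++ q
∈-++ʳ⁺ [] i∈q = i∈q
∈-++ʳ⁺ (_ ∷ p) i∈q = there (∈-++ʳ⁺ p i∈q)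

∈-++ʳ⁻ : ∀ {m n} (p : Subset m) {q : Subset n} {i} → m ↑ʳ i ∈ p ++ q → i ∈ q
∈-++ʳ⁻ [] i∈ = i∈
∈-++ʳ⁻ (_ ∷ p) (there i∈) = ∈-++ʳ⁻ p i∈

∣p∪q∣≤∣p∣+∣q∣ : ∀ {n} (p q : Subset n) → ∣ p ∪ q ∣ ≤ ∣ p ∣ + ∣ q ∣
∣p∪q∣≤∣p∣+∣q∣ [] [] = z≤n
∣p∪q∣≤∣p∣+∣q∣ (inside ∷ p) (x ∷ q) = s≤s (≤-trans (∣p∪q∣≤∣p∣+∣q∣ p q) (+-monoʳ-≤ ∣ p ∣ (∣p∣≤∣x∷p∣ x q)))
∣p∪q∣≤∣p∣+∣q∣ (outside ∷ p) (inside ∷ q) = subst (suc ∣ p ∪ q ∣ ≤_) (sym (+-suc ∣ p ∣ ∣ q ∣)) (s≤s (∣p∪q∣≤∣p∣+∣q∣ p q))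
∣p∪q∣≤∣p∣+∣q∣ (outside ∷ p) (outside ∷ q) = ∣p∪q∣≤∣p∣+∣q∣ p q

∣p∪q∣≡∣p∣+∣q∣ : ∀ {n} (p q : Subset n) → (∀ {i} → i ∈ p → i ∉ q) → ∣ p ∪ q ∣ ≡ ∣ p ∣ + ∣ q ∣
∣p∪q∣≡∣p∣+∣q∣ [] [] disjoint = refl
∣p∪q∣≡∣p∣+∣q∣ (x ∷ p) (y ∷ q) disjoint with ∣p∪q∣≡∣p∣+∣q∣ p q (λ i∈p i∈q → disjoint (there i∈p) (there i∈q))
∣p∪q∣≡∣p∣+∣q∣ (inside ∷ p) (inside ∷ q) disjoint | _ = ⊥-elim (disjoint here here)
∣p∪q∣≡∣p∣+∣q∣ (inside ∷ p) (outside ∷ q) disjoint | ih = cong suc ih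
∣p∪q∣≡∣p∣+∣q∣ (outside ∷ p) (inside ∷ q) disjoint | ih = trans (cong suc ih) (sym (+-suc ∣ p ∣ ∣ q ∣))
∣p∪q∣≡∣p∣+∣q∣ (outside ∷ p) (outside ∷ q) disjoint | ih = ih

injection⇒∣p∣≤∣q∣ : ∀ {m n} (f : Fin m → Fin n) {p : Subset m} {q : Subset n} →
  (∀ {i} → i ∈ p → f i ∈ q) → (∀ {i j} → i ∈ p → j ∈ p → f i ≡ f j → i ≡ j) → ∣ p ∣ ≤ ∣ q ∣
injection⇒∣p∣≤∣q∣ f {[]} into inj = z≤n
injection⇒∣p∣≤∣q∣ f {outside ∷ p} into inj =
  injection⇒∣p∣≤∣q∣ (f ∘ suc) (into ∘ there) (λ i∈ j∈ eq → suc-injective (inj (there i∈) (there j∈) eq))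
injection⇒∣p∣≤∣q∣ f {inside ∷ p} {q} into inj =
  <-≤-trans (s≤s rest) (x∈p⇒∣p-x∣<∣p∣ (into here))
  where
  rest : ∣ p ∣ ≤ ∣ q - f zero ∣
  rest = injection⇒∣p∣≤∣q∣ (f ∘ suc)
    (λ i∈ → x∈p∧x≢y⇒x∈p-y (into (there i∈)) (λ eq → 0≢1+n (sym (inj (there i∈) here eq))))
    (λ i∈ j∈ eq → suc-injective (inj (there i∈) (there j∈) eq))

injection-missing⇒∣p∣<∣q∣ : ∀ {m n} (f : Fin m → Fin n) {p : Subset m} {q : Subset n} {e : Fin n} →
  (∀ {i} → i ∈ p → f i ∈ q) → (∀ {i j} → i ∈ p → j ∈ p → f i ≡ f j → i ≡ j) →
  e ∈ q → (∀ {i} → i ∈ p → f i ≢ e) → ∣ p ∣ < ∣ q ∣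
injection-missing⇒∣p∣<∣q∣ f into inj e∈q missed =
  <-≤-trans (s≤s (injection⇒∣p∣≤∣q∣ f (λ i∈ → x∈p∧x≢y⇒x∈p-y (into i∈) (missed i∈)) inj)) (x∈p⇒∣p-x∣<∣p∣ e∈q)

image : ∀ {m n} → (Fin m → Fin n) → Subset m → Subset n
image f [] = ⊥
image f (inside ∷ p) = ⁅ f zero ⁆ ∪ image (f ∘ suc) p
image f (outside ∷ p) = image (f ∘ suc) p

∈-image : ∀ {m n} (f : Fin m → Fin n) {p : Subset m} {i} → i ∈ p → f i ∈ image f p
∈-image f {inside ∷ p} here = x∈p∪q⁺ (inj₁ (x∈⁅x⁆ (f zero)))
∈-image f {inside ∷ p} (there i∈p) = x∈p∪q⁺ (inj₂ (∈-image (f ∘ suc) i∈p))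
∈-image f {outside ∷ p} (there i∈p) = ∈-image (f ∘ suc) i∈p

∣image∣≤∣p∣ : ∀ {m n} (f : Fin m → Fin n) (p : Subset m) → ∣ image f p ∣ ≤ ∣ p ∣
∣image∣≤∣p∣ {n = n} f [] = ≤-reflexive (∣⊥∣≡0 n)
∣image∣≤∣p∣ f (inside ∷ p) = ≤-trans (∣p∪q∣≤∣p∣+∣q∣ ⁅ f zero ⁆ _)
  (subst (λ c → c + ∣ image (f ∘ suc) p ∣ ≤ suc ∣ p ∣) (sym (∣⁅x⁆∣≡1 (f zero))) (s≤s (∣image∣≤∣p∣ (f ∘ suc) p)))
∣image∣≤∣p∣ f (outside ∷ p) = ∣image∣≤∣p∣ (f ∘ suc) p

1≤∣p∣⇒nonempty : ∀ {n} (p : Subset n) → 1 ≤ ∣ p ∣ → Nonempty p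
1≤∣p∣⇒nonempty {n} p 1≤∣p∣ with nonempty? p
... | yes ne = ne
... | no empty with subst (λ s → 1 ≤ ∣ s ∣) (Empty-unique empty) 1≤∣p∣
...   | 1≤∣⊥∣ with subst (1 ≤_) (∣⊥∣≡0 n) 1≤∣⊥∣
...     | ()

∈⇒1≤∣p∣ : ∀ {n} {p : Subset n} {x} → x ∈ p → 1 ≤ ∣ p ∣
∈⇒1≤∣p∣ x∈p = <-≤-trans (s≤s z≤n) (x∈p⇒∣p-x∣<∣p∣ x∈p)

distinct⇒2≤∣p∣ : ∀ {n} {p : Subset n} {x y} → x ∈ p → y ∈ p → x ≢ y → 2 ≤ ∣ p ∣
distinct⇒2≤∣p∣ x∈p y∈p x≢y = <-≤-trans (s≤s (∈⇒1≤∣p∣ (x∈p∧x≢y⇒x∈p-y y∈p (x≢y ∘ sym)))) (x∈p⇒∣p-x∣<∣p∣ x∈p)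

2≤∣p∣⇒distinct : ∀ {n} (p : Subset n) → 2 ≤ ∣ p ∣ → Σ (Fin n) λ x → Σ (Fin n) λ y → x ∈ p × y ∈ p × x ≢ y
2≤∣p∣⇒distinct p 2≤∣p∣ with 1≤∣p∣⇒nonempty p (≤-trans (s≤s z≤n) 2≤∣p∣)
... | x , x∈p with any? (λ y → (y ∈? p) ×-dec ¬? (x ≟ y))
...   | yes (y , y∈p , x≢y) = x , y , x∈p , y∈p , x≢y
...   | no none = ⊥-elim (<-irrefl refl (≤-trans 2≤∣p∣ (≤-trans (p⊆q⇒∣p∣≤∣q∣ p⊆⁅x⁆) (≤-reflexive (∣⁅x⁆∣≡1 x)))))
  where
  p⊆⁅x⁆ : p ⊆ ⁅ x ⁆
  p⊆⁅x⁆ {y} y∈p with x ≟ y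
  ... | yes refl = x∈⁅x⁆ x
  ... | no x≢y = ⊥-elim (none (y , y∈p , x≢y))

module _ {n : ℕ} (H : Graph n) where

  edge-sym : ∀ {u v} → Edge H u v → Edge H v u
  edge-sym {u} {v} uv = trans (adj-sym H v u) uv

  edge-irrefl : ∀ {u} → ¬ Edge H u u
  edge-irrefl {u} uu with trans (sym (adj-irrefl H u)) uu
  ... | ()

  edge⇒≢ : ∀ {u v} → Edge H u v → u ≢ v
  edge⇒≢ uv refl = edge-irrefl uv

  edge? : ∀ u v → Dec (Edge H u v)
  edge? u v = adj H u v Bool.≟ true

  walk-++ : ∀ {x y z a b} → Walk H x y a → Walk H y z b → Walk H x z (a + b)
  walk-++ nil w = w
  walk-++ (cons e w) w′ = cons e (walk-++ w w′)

  walk-reverse : ∀ {x y a} → Walk H x y a → Walk H y x a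
  walk-reverse nil = nil
  walk-reverse {a = suc a} (cons e w) =
    subst (Walk H _ _) (trans (+-suc a 0) (cong suc (+-identityʳ a))) (walk-++ (walk-reverse w) (cons (edge-sym e) nil))

  reach-refl : ∀ {x} → Reach H x x
  reach-refl = 0 , nil

  reach-sym : ∀ {x y} → Reach H x y → Reach H y x
  reach-sym (a , w) = a , walk-reverse w

  reach-trans : ∀ {x y z} → Reach H x y → Reach H y z → Reach H x z
  reach-trans (a , w) (b , w′) = a + b , walk-++ w w′

  reach-edge : ∀ {x y} → Edge H x y → Reach H x y
  reach-edge e = 1 , cons e nil

  walk-0 : ∀ {x y} → Walk H x y 0 → x ≡ y
  walk-0 nil = refl

  walk-1 : ∀ {x y} → Walk H x y 1 → Edge H x y
  walk-1 (cons e nil) = e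

  walk-length≥2 : ∀ {x y m} → x ≢ y → ¬ Edge H x y → Walk H x y m → 2 ≤ m
  walk-length≥2 x≢y ¬xy nil = ⊥-elim (x≢y refl)
  walk-length≥2 x≢y ¬xy (cons e nil) = ⊥-elim (¬xy e)
  walk-length≥2 x≢y ¬xy (cons e (cons e′ w)) = s≤s (s≤s z≤n)

  on-geodesic : ∀ {x y z a b} → Walk H x z a → Walk H z y b → (∀ m → Walk H x y m → a + b ≤ m) → InInterval H x y z
  on-geodesic {a = a} {b} w w′ shortest = inj₂ (inj₂ (a , b , w , w′ , shortest))

  common-neighbour∈interval : ∀ {x y z} → x ≢ y → ¬ Edge H x y → Edge H x z → Edge H z y → InInterval H x y z
  common-neighbour∈interval x≢y ¬xy xz zy = on-geodesic (cons xz nil) (cons zy nil) (λ m → walk-length≥2 x≢y ¬xy)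

  interval-sym : ∀ {x y z} → InInterval H x y z → InInterval H y x z
  interval-sym (inj₁ z≡x) = inj₂ (inj₁ z≡x)
  interval-sym (inj₂ (inj₁ z≡y)) = inj₁ z≡y
  interval-sym (inj₂ (inj₂ (a , b , w , w′ , shortest))) =
    on-geodesic (walk-reverse w′) (walk-reverse w) (λ m wm → subst (_≤ m) (+-comm a b) (shortest m (walk-reverse wm)))

  interval-split : ∀ {x y z ℓ} → InInterval H x y z → Walk H x y ℓ →
    z ≡ x ⊎ z ≡ y ⊎ Σ ℕ λ a → Σ ℕ λ b → Walk H x z (suc a) × Walk H z y (suc b) × suc a + suc b ≤ ℓ
  interval-split (inj₁ z≡x) w = inj₁ z≡x
  interval-split (inj₂ (inj₁ z≡y)) w = inj₂ (inj₁ z≡y)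
  interval-split (inj₂ (inj₂ (zero , b , wa , wb , shortest))) w = inj₁ (sym (walk-0 wa))
  interval-split (inj₂ (inj₂ (suc a , zero , wa , wb , shortest))) w = inj₂ (inj₁ (walk-0 wb))
  interval-split (inj₂ (inj₂ (suc a , suc b , wa , wb , shortest))) w = inj₂ (inj₂ (a , b , wa , wb , shortest _ w))

  interval-adjacent : ∀ {x y z ℓ} → InInterval H x y z → Walk H x y ℓ → ℓ ≤ 1 → z ≡ x ⊎ z ≡ y
  interval-adjacent I w ℓ≤1 with interval-split I w
  ... | inj₁ z≡x = inj₁ z≡x
  ... | inj₂ (inj₁ z≡y) = inj₂ z≡y
  ... | inj₂ (inj₂ (a , b , _ , _ , ≤ℓ)) with ≤-trans ≤ℓ ℓ≤1
  ...   | s≤s a+sb≤0 with subst (_≤ 0) (+-suc a b) a+sb≤0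
  ...     | ()

  interval-distance2 : ∀ {x y z ℓ} → InInterval H x y z → Walk H x y ℓ → ℓ ≤ 2 →
    z ≡ x ⊎ z ≡ y ⊎ (Edge H x z × Edge H z y)
  interval-distance2 I w ℓ≤2 with interval-split I w
  ... | inj₁ z≡x = inj₁ z≡x
  ... | inj₂ (inj₁ z≡y) = inj₂ (inj₁ z≡y)
  ... | inj₂ (inj₂ (zero , zero , wa , wb , _)) = inj₂ (inj₂ (walk-1 wa , walk-1 wb))
  ... | inj₂ (inj₂ (zero , suc b , _ , _ , ≤ℓ)) with ≤-trans ≤ℓ ℓ≤2
  ...   | s≤s (s≤s ())
  interval-distance2 I w ℓ≤2 | inj₂ (inj₂ (suc a , b , _ , _ , ≤ℓ)) with ≤-trans ≤ℓ ℓ≤2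
  ...   | s≤s (s≤s a+sb≤0) with subst (_≤ 0) (+-suc a b) a+sb≤0
  ...     | ()

  interval-distance3 : ∀ {x y z ℓ} → InInterval H x y z → Walk H x y ℓ → ℓ ≤ 3 →
    z ≡ x ⊎ z ≡ y ⊎ (Edge H x z × Σ ℕ λ b → b ≤ 2 × Walk H z y b)
                    ⊎ ((Σ ℕ λ a → a ≤ 2 × Walk H x z a) × Edge H z y)
  interval-distance3 I w ℓ≤3 with interval-split I w
  ... | inj₁ z≡x = inj₁ z≡x
  ... | inj₂ (inj₁ z≡y) = inj₂ (inj₁ z≡y)
  ... | inj₂ (inj₂ (zero , b , wa , wb , ≤ℓ)) with ≤-trans ≤ℓ ℓ≤3
  ...   | s≤s sb≤2 = inj₂ (inj₂ (inj₁ (walk-1 wa , suc b , sb≤2 , wb)))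
  interval-distance3 I w ℓ≤3 | inj₂ (inj₂ (suc a , zero , wa , wb , ≤ℓ)) with ≤-trans ≤ℓ ℓ≤3
  ...   | s≤s sa+1≤2 = inj₂ (inj₂ (inj₂ ((suc (suc a) , subst (λ c → suc c ≤ 2) (+-comm a 1) sa+1≤2 , wa) , walk-1 wb)))
  interval-distance3 I w ℓ≤3 | inj₂ (inj₂ (suc a , suc b , wa , wb , ≤ℓ)) with ≤-trans ≤ℓ ℓ≤3
  ...   | s≤s (s≤s a+ssb≤1) with subst (_≤ 1) (+-suc a (suc b)) a+ssb≤1
  ...     | s≤s a+sb≤0 with subst (_≤ 0) (+-suc a b) a+sb≤0
  ...       | ()

module _ {n : ℕ} (G : Graph n) where

  complement-edge⁻ : ∀ {i j} → Edge (complement G) i j → i ≢ j × ¬ Edge G i j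
  complement-edge⁻ {i} {j} e with i ≟ j | adj G i j
  ... | no i≢j | false = i≢j , λ ()
  complement-edge⁻ () | yes _ | _
  complement-edge⁻ () | no _ | true

  edge-trichotomy : ∀ i j → i ≡ j ⊎ Edge G i j ⊎ Edge (complement G) i j
  edge-trichotomy i j with i ≟ j | adj G i j
  ... | yes i≡j | _ = inj₁ i≡j
  ... | no _ | true = inj₂ (inj₁ refl)
  ... | no _ | false = inj₂ (inj₂ refl)

  non-complement-edge : ∀ {i j} → i ≢ j → ¬ Edge (complement G) i j → Edge G i j
  non-complement-edge i≢j ¬ij̄ with edge-trichotomy _ _
  ... | inj₁ i≡j = ⊥-elim (i≢j i≡j)
  ... | inj₂ (inj₁ ij) = ij
  ... | inj₂ (inj₂ ij̄) = ⊥-elim (¬ij̄ ij̄)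

  separated⇒edge : ∀ {u v} → ¬ Reach (complement G) u v → Edge G u v
  separated⇒edge u⇸v = non-complement-edge (λ { refl → u⇸v (reach-refl (complement G)) }) (u⇸v ∘ reach-edge (complement G))

complement-cograph : ∀ {n} (G : Graph n) → Cograph G → Cograph (complement G)
complement-cograph G cg a b c d (ab , bc , cd , ¬ac , ¬bd , ¬ad) =
  cg b d a c (in-G b≢d ¬bd , in-G d≢a (¬ad ∘ edge-sym Ḡ) , in-G a≢c ¬ac ,
              proj₂ (complement-edge⁻ G (edge-sym Ḡ ab)) , proj₂ (complement-edge⁻ G (edge-sym Ḡ cd)) , proj₂ (complement-edge⁻ G bc))
  where
  Ḡ = complement G
  in-G = non-complement-edge G
  b≢d : b ≢ d
  b≢d refl = ¬ad ab
  d≢a : d ≢ a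
  d≢a refl = ¬ac (edge-sym Ḡ cd)
  a≢c : a ≢ c
  a≢c refl = ¬ad cd

induced-cograph : ∀ {m n} (G : Graph n) (ι : Fin m → Fin n) → Cograph G → Cograph (induced G ι)
induced-cograph G ι cg a b c d = cg (ι a) (ι b) (ι c) (ι d)

module _ {n : ℕ} {H : Graph n} (cg : Cograph H) where

  shortcut3 : ∀ {u a b y} → Edge H u a → Edge H a b → Edge H b y → Σ ℕ λ ℓ → ℓ ≤ 2 × Walk H u y ℓ
  shortcut3 {u} {a} {b} {y} ua ab by with edge? H u b | edge? H a y | edge? H u y
  ... | yes ub | _ | _ = 2 , ≤-refl , cons ub (cons by nil)
  ... | no _ | yes ay | _ = 2 , ≤-refl , cons ua (cons ay nil)
  ... | no _ | no _ | yes uy = 1 , s≤s z≤n , cons uy nil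
  ... | no ¬ub | no ¬ay | no ¬uy = ⊥-elim (cg u a b y (ua , ab , by , ¬ub , ¬ay , ¬uy))

  cograph-diameter≤2 : ∀ {x y ℓ} → Walk H x y ℓ → Σ ℕ λ ℓ′ → ℓ′ ≤ 2 × Walk H x y ℓ′
  cograph-diameter≤2 nil = 0 , z≤n , nil
  cograph-diameter≤2 (cons e w) with cograph-diameter≤2 w
  ... | 0 , _ , nil = 1 , s≤s z≤n , cons e nil
  ... | 1 , _ , cons e₂ nil = 2 , ≤-refl , cons e (cons e₂ nil)
  ... | 2 , _ , cons e₂ (cons e₃ nil) = shortcut3 e e₂ e₃
  ... | suc (suc (suc _)) , s≤s (s≤s ()) , _

  -- Hence reachability in a cograph is decidable: search walks of length ≤ 2.
  reach? : ∀ u v → Dec (Reach H u v)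
  reach? u v with u ≟ v | edge? H u v | any? (λ w → edge? H u w ×-dec edge? H w v)
  ... | yes refl | _ | _ = yes (reach-refl H)
  ... | no _ | yes uv | _ = yes (reach-edge H uv)
  ... | no _ | no _ | yes (w , uw , wv) = yes (2 , cons uw (cons wv nil))
  ... | no u≢v | no ¬uv | no ¬uwv = no λ r → short-walk-impossible (cograph-diameter≤2 (proj₂ r))
    where
    short-walk-impossible : ¬ (Σ ℕ λ ℓ → ℓ ≤ 2 × Walk H u v ℓ)
    short-walk-impossible (0 , _ , nil) = u≢v refl
    short-walk-impossible (1 , _ , cons uv nil) = ¬uv uv
    short-walk-impossible (2 , _ , cons uw (cons wv nil)) = ¬uwv (_ , uw , wv)
    short-walk-impossible (suc (suc (suc _)) , s≤s (s≤s ()) , _)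

record Representatives {n} (H : Graph n) (R : Subset n) : Set where
  field
    represent : ∀ v → Σ (Fin n) λ r → r ∈ R × Reach H v r
    separate  : ∀ {r r′} → r ∈ R → r′ ∈ R → Reach H r r′ → r ≡ r′

Isolated : ∀ {n} → Graph n → Fin n → Set
Isolated H v = ∀ w → ¬ Edge H v w

isolated-reach : ∀ {n} (H : Graph n) {v w} → Isolated H v → Reach H v w → w ≡ v
isolated-reach H iso (_ , nil) = refl
isolated-reach H iso (_ , cons e _) = ⊥-elim (iso _ e)

endpoint∈ : ∀ {n} {C : Subset n} {x y z} → x ∈ C → y ∈ C → z ≡ x ⊎ z ≡ y → z ∈ C
endpoint∈ x∈ y∈ (inj₁ refl) = x∈
endpoint∈ x∈ y∈ (inj₂ refl) = y∈

-- A hull set of a graph with at least one vertex is nonempty (∅ is convex).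
hull-set-nonempty : ∀ {n} (H : Graph n) {S} → IsHullSet H S → Fin n → Nonempty S
hull-set-nonempty H {S} hull v with nonempty? S
... | yes ne = ne
... | no empty = ⊥-elim (∉⊥ (hull ⊥ (λ x∈S → ⊥-elim (empty (_ , x∈S))) (λ x y z x∈⊥ _ _ → ⊥-elim (∉⊥ x∈⊥)) v))

-- In a cograph, a set is convex as soon as it contains the common neighbours
-- of its distinct non-adjacent pairs (intervals have length ≤ 2).
cograph-convex : ∀ {n} {H : Graph n} → Cograph H → (C : Subset n) →
  (∀ {x y z} → x ∈ C → y ∈ C → x ≢ y → ¬ Edge H x y → Edge H x z → Edge H z y → z ∈ C) → Convex H C
cograph-convex cg C closed x y z x∈ y∈ (inj₁ refl) = x∈
cograph-convex cg C closed x y z x∈ y∈ (inj₂ (inj₁ refl)) = y∈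
cograph-convex {H = H} cg C closed x y z x∈ y∈ I@(inj₂ (inj₂ (_ , _ , wa , wb , _))) with x ≟ y | edge? H x y
... | yes refl | _ = endpoint∈ x∈ y∈ (interval-adjacent H I nil z≤n)
... | no _ | yes xy = endpoint∈ x∈ y∈ (interval-adjacent H I (cons xy nil) ≤-refl)
... | no x≢y | no ¬xy with cograph-diameter≤2 cg (walk-++ H wa wb)
...   | ℓ , ℓ≤2 , w with interval-distance2 H I w ℓ≤2
...     | inj₁ refl = x∈
...     | inj₂ (inj₁ refl) = y∈
...     | inj₂ (inj₂ (xz , zy)) = closed x∈ y∈ x≢y ¬xy xz zy

record InducedEmbedding {m n} (A : Graph m) (B : Graph n) (f : Fin m → Fin n) : Set where
  field
    injective : ∀ {i j} → f i ≡ f j → i ≡ j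
    edge⁺ : ∀ {i j} → Edge A i j → Edge B (f i) (f j)
    edge⁻ : ∀ {i j} → Edge B (f i) (f j) → Edge A i j

-- Hull sets transfer along induced embeddings of cographs: a convex set of B
-- containing the image of a hull set of A contains the image of all of A.
-- (Its preimage is closed under common neighbours, hence convex in A.)
hull-transfer : ∀ {m n} {A : Graph m} {B : Graph n} {f : Fin m → Fin n} →
  Cograph A → InducedEmbedding A B f → ∀ K → Convex B K →
  ∀ S → IsHullSet A S → (∀ {i} → i ∈ S → f i ∈ K) → ∀ i → f i ∈ K
hull-transfer {A = A} {B} {f} cg emb K convex S hull S↦K i =
  ∈⟦⟧⁻ mapped? (hull preimage (∈⟦⟧⁺ mapped? ∘ S↦K) preimage-convex i)
  where
  open InducedEmbedding emb
  mapped? : ∀ j → Dec (f j ∈ K)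
  mapped? j = f j ∈? K
  preimage : Subset _
  preimage = ⟦ mapped? ⟧
  preimage-convex : Convex A preimage
  preimage-convex = cograph-convex cg preimage λ x∈ y∈ x≢y ¬xy xz zy →
    ∈⟦⟧⁺ mapped? (convex _ _ _ (∈⟦⟧⁻ mapped? x∈) (∈⟦⟧⁻ mapped? y∈)
      (common-neighbour∈interval B (x≢y ∘ injective) (¬xy ∘ edge⁻) (edge⁺ xz) (edge⁺ zy)))

-- Seinsche: a connected cograph on at least two vertices has a disconnected
-- complement.  Fix u.  For a neighbour a of u let P(a) be the set of
-- neighbours of a not adjacent to u.  If Ḡ were connected, every such a would
-- have another neighbour a′ of u with P(a) ⊂ P(a′), which is impossible since
-- the sets P(a) are bounded in size by n.
module _ {n : ℕ} (G : Graph n) (cg : Cograph G) (connected : Connected G) (u : Fin n) where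

  private
    Ḡ = complement G
    cgḠ = complement-cograph G cg

  private-neighbour? : ∀ a b → Dec (Edge G a b × ¬ Edge G u b)
  private-neighbour? a b = edge? G a b ×-dec ¬? (edge? G u b)

  private-neighbours : Fin n → Subset n
  private-neighbours a = ⟦ private-neighbour? a ⟧

  Larger : Fin n → Set
  Larger a = Σ (Fin n) λ a′ → Edge G u a′ × private-neighbours a ⊂ private-neighbours a′

  grow : Connected Ḡ → ∀ a → Edge G u a → Larger a
  grow connectedḠ a ua = via-Ḡ (cograph-diameter≤2 cgḠ (proj₂ (connectedḠ u a)))
    where
    via-Ḡ : (Σ ℕ λ ℓ → ℓ ≤ 2 × Walk Ḡ u a ℓ) → Larger a
    via-Ḡ (0 , _ , nil) = ⊥-elim (edge-irrefl G ua)
    via-Ḡ (1 , _ , cons uā nil) = ⊥-elim (proj₂ (complement-edge⁻ G uā) ua)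
    via-Ḡ (suc (suc (suc _)) , s≤s (s≤s ()) , _)
    via-Ḡ (2 , _ , cons {w = b′} ub̄′ (cons b̄′a nil)) = via-G (cograph-diameter≤2 cg (proj₂ (connected u b′)))
      where
      ¬ub′ : ¬ Edge G u b′
      ¬ub′ = proj₂ (complement-edge⁻ G ub̄′)
      ¬ab′ : ¬ Edge G a b′
      ¬ab′ = proj₂ (complement-edge⁻ G b̄′a) ∘ edge-sym G
      inherit : ∀ a′ → Edge G u a′ → Edge G a′ b′ → private-neighbours a ⊆ private-neighbours a′
      inherit a′ ua′ a′b′ {b} b∈ with ∈⟦⟧⁻ (private-neighbour? a) b∈
      ... | ab , ¬ub with edge? G a′ b
      ...   | yes a′b = ∈⟦⟧⁺ (private-neighbour? a′) (a′b , ¬ub)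
      -- otherwise b a u a′, b′ b a u or b a a′ b′ is an induced P₄
      ...   | no ¬a′b with edge? G a a′ | edge? G b b′
      ...     | no ¬aa′ | _ = ⊥-elim (cg b a u a′
                (edge-sym G ab , edge-sym G ua , ua′ , ¬ub ∘ edge-sym G , ¬aa′ , ¬a′b ∘ edge-sym G))
      ...     | yes aa′ | yes bb′ = ⊥-elim (cg b′ b a u
                (edge-sym G bb′ , edge-sym G ab , edge-sym G ua , ¬ab′ ∘ edge-sym G , ¬ub ∘ edge-sym G , ¬ub′ ∘ edge-sym G))
      ...     | yes aa′ | no ¬bb′ = ⊥-elim (cg b a a′ b′
                (edge-sym G ab , aa′ , a′b′ , ¬a′b ∘ edge-sym G , ¬ab′ , ¬bb′))
      via-G : (Σ ℕ λ ℓ → ℓ ≤ 2 × Walk G u b′ ℓ) → Larger a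
      via-G (0 , _ , nil) = ⊥-elim (edge-irrefl Ḡ ub̄′)
      via-G (1 , _ , cons ub′ nil) = ⊥-elim (¬ub′ ub′)
      via-G (suc (suc (suc _)) , s≤s (s≤s ()) , _)
      via-G (2 , _ , cons {w = a′} ua′ (cons a′b′ nil)) =
        a′ , ua′ , inherit a′ ua′ a′b′ , b′ , ∈⟦⟧⁺ (private-neighbour? a′) (a′b′ , ¬ub′) ,
        λ b′∈ → ¬ab′ (proj₁ (∈⟦⟧⁻ (private-neighbour? a) b′∈))

  unbounded : Connected Ḡ → ∀ a → Edge G u a → ∀ j → Σ (Fin n) λ a′ → Edge G u a′ × j ≤ ∣ private-neighbours a′ ∣
  unbounded connectedḠ a ua zero = a , ua , z≤n
  unbounded connectedḠ a ua (suc j) with unbounded connectedḠ a ua j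
  ... | a′ , ua′ , j≤ with grow connectedḠ a′ ua′
  ...   | a″ , ua″ , ⊂ = a″ , ua″ , <-≤-trans (s≤s j≤) (p⊂q⇒∣p∣<∣q∣ ⊂)

connected-cograph⇒disconnected-complement : ∀ {n} (G : Graph n) → 2 ≤ n → Connected G → Cograph G → ¬ Connected (complement G)
connected-cograph⇒disconnected-complement {suc zero} G (s≤s ()) _ _ _
connected-cograph⇒disconnected-complement {suc (suc n)} G _ connected cg connectedḠ with connected zero (suc zero)
... | _ , cons {w = a} ua _ with unbounded G cg connected zero connectedḠ a ua (suc (suc (suc n)))
...   | a′ , _ , too-big = <-irrefl refl (≤-trans too-big (∣p∣≤n (private-neighbours G cg connected zero a′)))

module Prism {n : ℕ} (G : Graph n) where

  private
    Ḡ = complement G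
    P = prism G

  vG vḠ : Fin n → Fin (n + n)
  vG i = i ↑ˡ n
  vḠ i = n ↑ʳ i

  vG-injective : ∀ {i j} → vG i ≡ vG j → i ≡ j
  vG-injective = ↑ˡ-injective n _ _

  vḠ-injective : ∀ {i j} → vḠ i ≡ vḠ j → i ≡ j
  vḠ-injective = ↑ʳ-injective n _ _

  vG≢vḠ : ∀ {i j} → vG i ≢ vḠ j
  vG≢vḠ {i} {j} eq with trans (sym (splitAt-↑ˡ n i n)) (trans (cong (splitAt n) eq) (splitAt-↑ʳ n n j))
  ... | ()

  data Side : Fin (n + n) → Set where
    inG : ∀ i → Side (vG i)
    inḠ : ∀ i → Side (vḠ i)

  side : ∀ v → Side v
  side v with splitAt n v in eq
  ... | inj₁ i = subst Side (splitAt⁻¹-↑ˡ eq) (inG i)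
  ... | inj₂ i = subst Side (splitAt⁻¹-↑ʳ eq) (inḠ i)

  GG-edge⁺ : ∀ {i j} → Edge G i j → Edge P (vG i) (vG j)
  GG-edge⁺ {i} {j} e rewrite splitAt-↑ˡ n i n | splitAt-↑ˡ n j n = e

  GG-edge⁻ : ∀ {i j} → Edge P (vG i) (vG j) → Edge G i j
  GG-edge⁻ {i} {j} e rewrite splitAt-↑ˡ n i n | splitAt-↑ˡ n j n = e

  ḠḠ-edge⁺ : ∀ {i j} → Edge Ḡ i j → Edge P (vḠ i) (vḠ j)
  ḠḠ-edge⁺ {i} {j} e rewrite splitAt-↑ʳ n n i | splitAt-↑ʳ n n j = e

  ḠḠ-edge⁻ : ∀ {i j} → Edge P (vḠ i) (vḠ j) → Edge Ḡ i j
  ḠḠ-edge⁻ {i} {j} e rewrite splitAt-↑ʳ n n i | splitAt-↑ʳ n n j = e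

  matching-edge : ∀ i → Edge P (vG i) (vḠ i)
  matching-edge i rewrite splitAt-↑ˡ n i n | splitAt-↑ʳ n n i with i ≟ i
  ... | yes _ = refl
  ... | no i≢i = ⊥-elim (i≢i refl)

  matching-edge⁻ : ∀ {i j} → Edge P (vG i) (vḠ j) → i ≡ j
  matching-edge⁻ {i} {j} e rewrite splitAt-↑ˡ n i n | splitAt-↑ʳ n n j with i ≟ j
  ... | yes i≡j = i≡j
  matching-edge⁻ () | no _

  matching-edge⁻′ : ∀ {i j} → Edge P (vḠ i) (vG j) → i ≡ j
  matching-edge⁻′ e = sym (matching-edge⁻ (edge-sym P e))

  ḠḠ-short-walk⇒reach : ∀ {u v m} → Walk P (vḠ u) (vḠ v) m → m ≤ 2 → Reach Ḡ u v
  ḠḠ-short-walk⇒reach w m≤2 = go w m≤2 refl refl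
    where
    go : ∀ {x y m u v} → Walk P x y m → m ≤ 2 → x ≡ vḠ u → y ≡ vḠ v → Reach Ḡ u v
    go nil _ refl y≡ = subst (Reach Ḡ _) (vḠ-injective y≡) (reach-refl Ḡ)
    go (cons e nil) _ refl refl = reach-edge Ḡ (ḠḠ-edge⁻ e)
    go (cons {w = z} e (cons e′ nil)) _ refl refl with side z
    ... | inG i = subst (Reach Ḡ _) (trans (matching-edge⁻′ e) (matching-edge⁻ e′)) (reach-refl Ḡ)
    ... | inḠ i = reach-trans Ḡ (reach-edge Ḡ (ḠḠ-edge⁻ e)) (reach-edge Ḡ (ḠḠ-edge⁻ e′))
    go (cons e (cons e′ (cons _ _))) (s≤s (s≤s ())) _ _

  -- If u, v lie in different components of Ḡ then v̄_u v_u v_v v̄_v is a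
  -- geodesic, so v_u ∈ I[v̄_u, v̄_v].
  separated⇒vG∈interval : ∀ {u v} → ¬ Reach Ḡ u v → InInterval P (vḠ u) (vḠ v) (vG u)
  separated⇒vG∈interval {u} {v} u⇸v =
    on-geodesic P (cons (edge-sym P (matching-edge u)) nil) (cons (GG-edge⁺ (separated⇒edge G u⇸v)) (cons (matching-edge v) nil)) distance≥3
    where
    distance≥3 : ∀ m → Walk P (vḠ u) (vḠ v) m → 3 ≤ m
    distance≥3 (suc (suc (suc m))) w = s≤s (s≤s (s≤s z≤n))
    distance≥3 0 w = ⊥-elim (u⇸v (ḠḠ-short-walk⇒reach w z≤n))
    distance≥3 1 w = ⊥-elim (u⇸v (ḠḠ-short-walk⇒reach w (s≤s z≤n)))
    distance≥3 2 w = ⊥-elim (u⇸v (ḠḠ-short-walk⇒reach w ≤-refl))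

  walk-vG-vḠ : ∀ a b → Σ ℕ λ ℓ → ℓ ≤ 2 × Walk P (vG a) (vḠ b) ℓ
  walk-vG-vḠ a b with edge-trichotomy G a b
  ... | inj₁ refl = 1 , s≤s z≤n , cons (matching-edge a) nil
  ... | inj₂ (inj₁ ab) = 2 , ≤-refl , cons (GG-edge⁺ ab) (cons (matching-edge b) nil)
  ... | inj₂ (inj₂ ab̄) = 2 , ≤-refl , cons (matching-edge a) (cons (ḠḠ-edge⁺ ab̄) nil)

  walk-vḠ-vḠ : ∀ a b → Σ ℕ λ ℓ → ℓ ≤ 3 × Walk P (vḠ a) (vḠ b) ℓ
  walk-vḠ-vḠ a b with edge-trichotomy G a b
  ... | inj₁ refl = 0 , z≤n , nil
  ... | inj₂ (inj₁ ab) = 3 , ≤-refl , cons (edge-sym P (matching-edge a)) (cons (GG-edge⁺ ab) (cons (matching-edge b) nil))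
  ... | inj₂ (inj₂ ab̄) = 1 , s≤s z≤n , cons (ḠḠ-edge⁺ ab̄) nil

  module _ (K : Subset (n + n)) (convex : Convex P K) where

    separated-closure : ∀ {u v} → vḠ u ∈ K → vḠ v ∈ K → ¬ Reach Ḡ u v → vG u ∈ K
    separated-closure u∈ v∈ u⇸v = convex _ _ _ u∈ v∈ (separated⇒vG∈interval u⇸v)

    common-neighbour-closure : ∀ {x y z} → vG x ∈ K → vG y ∈ K → x ≢ y → ¬ Edge G x y →
      Edge G x z → Edge G z y → vG z ∈ K
    common-neighbour-closure x∈ y∈ x≢y ¬xy xz zy = convex _ _ _ x∈ y∈
      (common-neighbour∈interval P (x≢y ∘ vG-injective) (¬xy ∘ GG-edge⁻) (GG-edge⁺ xz) (GG-edge⁺ zy))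

    -- If v_p, v_q ∈ K for a Ḡ-edge pq, then v_z ∈ K for every z outside the
    -- Ḡ-component of p and q (such z is G-adjacent to both).
    component-edge-closure : ∀ {p q z} → vG p ∈ K → vG q ∈ K → Edge Ḡ p q → ¬ Reach Ḡ z q → vG z ∈ K
    component-edge-closure {p} {q} p∈ q∈ pq z⇸q =
      common-neighbour-closure p∈ q∈ (edge⇒≢ Ḡ pq) (proj₂ (complement-edge⁻ G pq))
        (edge-sym G (separated⇒edge G (λ z→p → z⇸q (reach-trans Ḡ z→p (reach-edge Ḡ pq))))) (separated⇒edge G z⇸q)

    spread-in-component : (∀ i → vG i ∈ K) → ∀ {u v} → vḠ u ∈ K → Reach Ḡ u v → vḠ v ∈ K
    spread-in-component allG u∈ (_ , w) = go w u∈
      where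
      go : ∀ {u v ℓ} → Walk Ḡ u v ℓ → vḠ u ∈ K → vḠ v ∈ K
      go nil u∈ = u∈
      go {u} (cons {w = x} ux w) u∈ = go w (convex (vG x) (vḠ u) (vḠ x) (allG x) u∈
        (common-neighbour∈interval P vG≢vḠ (λ e → edge⇒≢ Ḡ ux (sym (matching-edge⁻ e))) (matching-edge x) (ḠḠ-edge⁺ (edge-sym Ḡ ux))))

    everything : (∀ i → vG i ∈ K) → (∀ v → Σ (Fin n) λ u → vḠ u ∈ K × Reach Ḡ u v) → ∀ x → x ∈ K
    everything allG meets x with side x
    ... | inG i = allG i
    ... | inḠ i with meets i
    ...   | u , u∈ , u→i = spread-in-component allG u∈ u→i

module HullsOfPrism {n : ℕ} (G : Graph n) (cg : Cograph G) (Ḡ-disconnected : ¬ Connected (complement G)) where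

  open Prism G

  private
    Ḡ = complement G
    P = prism G

  reachḠ? : ∀ u v → Dec (Reach Ḡ u v)
  reachḠ? = reach? (complement-cograph G cg)

  another-component : ∀ x → Σ (Fin n) λ o → ¬ Reach Ḡ x o
  another-component x with ¬∀⟶∃¬ n _ (λ p → all? (reachḠ? p)) (λ all → Ḡ-disconnected λ p q → all p q)
  ... | p , p↛ with ¬∀⟶∃¬ n _ (reachḠ? p) p↛
  ...   | q , p⇸q with reachḠ? x p
  ...     | no x⇸p = p , x⇸p
  ...     | yes x→p = q , λ x→q → p⇸q (reach-trans Ḡ (reach-sym Ḡ x→p) x→q)

  not-an-end : ∀ {a b w} → ¬ (vḠ w ≡ vG a ⊎ vḠ w ≡ vG b)
  not-an-end (inj₁ eq) = vG≢vḠ (sym eq)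
  not-an-end (inj₂ eq) = vG≢vḠ (sym eq)

  -- No v̄-vertex lies on a geodesic between two v-vertices: if a ≠ b are not
  -- G-adjacent, a vertex of another Ḡ-component is a common G-neighbour.
  Ḡ-copy-avoids-G-intervals : ∀ {a b w} → ¬ InInterval P (vG a) (vG b) (vḠ w)
  Ḡ-copy-avoids-G-intervals {a} {b} {w} I with edge-trichotomy G a b
  ... | inj₁ refl = not-an-end (interval-adjacent P I nil z≤n)
  ... | inj₂ (inj₁ ab) = not-an-end (interval-adjacent P I (cons (GG-edge⁺ ab) nil) ≤-refl)
  ... | inj₂ (inj₂ ab̄) with another-component a
  ...   | o , a⇸o with interval-distance2 P I (cons (GG-edge⁺ (separated⇒edge G a⇸o)) (cons (GG-edge⁺ (separated⇒edge G o⇸b)) nil)) ≤-refl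
    where
    o⇸b : ¬ Reach Ḡ o b
    o⇸b o→b = a⇸o (reach-trans Ḡ (reach-edge Ḡ ab̄) (reach-sym Ḡ o→b))
  ...     | inj₁ eq = not-an-end {b = b} (inj₁ eq)
  ...     | inj₂ (inj₁ eq) = not-an-end {a = a} (inj₂ eq)
  ...     | inj₂ (inj₂ (aw , wb)) = edge⇒≢ Ḡ ab̄ (trans (matching-edge⁻ aw) (matching-edge⁻′ wb))

  outside? : ∀ r u → Dec (¬ Reach Ḡ u r)
  outside? r u = ¬? (reachḠ? u r)

  outside-component : Fin n → Subset (n + n)
  outside-component r = ⊤ ++ ⟦ outside? r ⟧

  outside-component-convex : ∀ r → Convex P (outside-component r)
  outside-component-convex r x y z x∈ y∈ I with side z
  ... | inG i = ∈-++ˡ⁺ _ ∈⊤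
  ... | inḠ w = ∈-++ʳ⁺ ⊤ (∈⟦⟧⁺ (outside? r) (stays-outside (side x) (side y) x∈ y∈ I))
    where
    outside⁻ : ∀ {u} → vḠ u ∈ outside-component r → ¬ Reach Ḡ u r
    outside⁻ u∈ = ∈⟦⟧⁻ (outside? r) (∈-++ʳ⁻ ⊤ u∈)
    across : ∀ {u w} → ¬ Reach Ḡ u r → Edge P (vḠ u) (vḠ w) → ¬ Reach Ḡ w r
    across u⇸r uw w→r = u⇸r (reach-trans Ḡ (reach-edge Ḡ (ḠḠ-edge⁻ uw)) w→r)
    same : ∀ {u} → ¬ Reach Ḡ u r → vḠ w ≡ vḠ u → ¬ Reach Ḡ w r
    same u⇸r eq = subst (λ v → ¬ Reach Ḡ v r) (sym (vḠ-injective eq)) u⇸r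
    mixed : ∀ {a b} → ¬ Reach Ḡ b r → InInterval P (vG a) (vḠ b) (vḠ w) → ¬ Reach Ḡ w r
    mixed {a} {b} b⇸r I with walk-vG-vḠ a b
    ... | ℓ , ℓ≤2 , walk with interval-distance2 P I walk ℓ≤2
    ...   | inj₁ eq = ⊥-elim (vG≢vḠ (sym eq))
    ...   | inj₂ (inj₁ eq) = same b⇸r eq
    ...   | inj₂ (inj₂ (_ , wb)) = across b⇸r (edge-sym P wb)
    stays-outside : ∀ {x y} → Side x → Side y → x ∈ outside-component r → y ∈ outside-component r →
      InInterval P x y (vḠ w) → ¬ Reach Ḡ w r
    stays-outside (inG a) (inG b) _ _ I = ⊥-elim (Ḡ-copy-avoids-G-intervals I)
    stays-outside (inG a) (inḠ b) _ b∈ I = mixed (outside⁻ b∈) I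
    stays-outside (inḠ a) (inG b) a∈ _ I = mixed (outside⁻ a∈) (interval-sym P I)
    stays-outside (inḠ a) (inḠ b) a∈ b∈ I with walk-vḠ-vḠ a b
    ... | ℓ , ℓ≤3 , walk with interval-distance3 P I walk ℓ≤3
    ...   | inj₁ eq = same (outside⁻ a∈) eq
    ...   | inj₂ (inj₁ eq) = same (outside⁻ b∈) eq
    ...   | inj₂ (inj₂ (inj₁ (aw , _))) = across (outside⁻ a∈) aw
    ...   | inj₂ (inj₂ (inj₂ (_ , wb))) = across (outside⁻ b∈) (edge-sym P wb)

  hull-set-meets-component : ∀ S → IsHullSet P S → ∀ r → Σ (Fin n) λ u → vḠ u ∈ S × Reach Ḡ u r
  hull-set-meets-component S hull r with any? (λ u → (vḠ u ∈? S) ×-dec reachḠ? u r)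
  ... | yes found = found
  ... | no none = ⊥-elim (r-outside (reach-refl Ḡ))
    where
    S⊆ : S ⊆ outside-component r
    S⊆ {x} x∈S with side x
    ... | inG i = ∈-++ˡ⁺ _ ∈⊤
    ... | inḠ u = ∈-++ʳ⁺ ⊤ (∈⟦⟧⁺ (outside? r) (λ u→r → none (u , x∈S , u→r)))
    r-outside : ¬ Reach Ḡ r r
    r-outside = ∈⟦⟧⁻ (outside? r) (∈-++ʳ⁻ ⊤ (hull (outside-component r) S⊆ (outside-component-convex r) (vḠ r)))

  -- If the members of T lie in pairwise distinct components of Ḡ, then
  -- {v_u, v̄_u : u ∈ T} is convex (distinct u, v ∈ T are G-adjacent, so all
  -- intervals between these vertices have length ≤ 3 and stay inside).
  doubled-convex : ∀ T → (∀ {u v} → u ∈ T → v ∈ T → Reach Ḡ u v → u ≡ v) → Convex P (T ++ T)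
  doubled-convex T separate x y z x∈ y∈ I = go (side x) (side y) x∈ y∈ I
    where
    vG∈ : ∀ {u} → u ∈ T → vG u ∈ T ++ T
    vG∈ = ∈-++ˡ⁺ T
    T-separated : ∀ {a b} → a ∈ T → b ∈ T → a ≢ b → ¬ Reach Ḡ a b
    T-separated a∈ b∈ a≢b a→b = a≢b (separate a∈ b∈ a→b)
    T-edge : ∀ {a b} → a ∈ T → b ∈ T → a ≢ b → Edge P (vG a) (vG b)
    T-edge a∈ b∈ a≢b = GG-edge⁺ (separated⇒edge G (T-separated a∈ b∈ a≢b))
    from-Ḡ : ∀ {a b z ℓ} → a ∈ T → b ∈ T → a ≢ b → Edge P (vḠ a) z → Walk P z (vḠ b) ℓ → ℓ ≤ 2 → z ∈ T ++ T
    from-Ḡ {a} {z = z} a∈ b∈ a≢b az walk ℓ≤2 with side z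
    ... | inG w = subst (λ u → vG u ∈ T ++ T) (matching-edge⁻′ az) (vG∈ a∈)
    ... | inḠ w = ⊥-elim (T-separated a∈ b∈ a≢b (reach-trans Ḡ (reach-edge Ḡ (ḠḠ-edge⁻ az)) (ḠḠ-short-walk⇒reach walk ℓ≤2)))
    mixed : ∀ {a b z} → a ∈ T → b ∈ T → InInterval P (vG a) (vḠ b) z → z ∈ T ++ T
    mixed {a} {b} {z} a∈ b∈ I with a ≟ b
    ... | yes refl = endpoint∈ (vG∈ a∈) (∈-++ʳ⁺ T a∈) (interval-adjacent P I (cons (matching-edge a) nil) ≤-refl)
    ... | no a≢b with interval-distance2 P I (cons (T-edge a∈ b∈ a≢b) (cons (matching-edge b) nil)) ≤-refl
    ...   | inj₁ refl = vG∈ a∈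
    ...   | inj₂ (inj₁ refl) = ∈-++ʳ⁺ T b∈
    ...   | inj₂ (inj₂ (az , zb)) with side z
    ...     | inG w = subst (λ u → vG u ∈ T ++ T) (sym (matching-edge⁻ zb)) (vG∈ b∈)
    ...     | inḠ w = ⊥-elim (T-separated a∈ b∈ a≢b (subst (λ u → Reach Ḡ u b) (sym (matching-edge⁻ az)) (reach-edge Ḡ (ḠḠ-edge⁻ zb))))
    go : ∀ {x y z} → Side x → Side y → x ∈ T ++ T → y ∈ T ++ T → InInterval P x y z → z ∈ T ++ T
    go (inG a) (inG b) x∈ y∈ I with a ≟ b
    ... | yes refl = endpoint∈ x∈ y∈ (interval-adjacent P I nil z≤n)
    ... | no a≢b = endpoint∈ x∈ y∈ (interval-adjacent P I (cons (T-edge (∈-++ˡ⁻ T x∈) (∈-++ˡ⁻ T y∈) a≢b) nil) ≤-refl)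
    go (inG a) (inḠ b) x∈ y∈ I = mixed (∈-++ˡ⁻ T x∈) (∈-++ʳ⁻ T y∈) I
    go (inḠ a) (inG b) x∈ y∈ I = mixed (∈-++ˡ⁻ T y∈) (∈-++ʳ⁻ T x∈) (interval-sym P I)
    go (inḠ a) (inḠ b) x∈ y∈ I with a ≟ b
    ... | yes refl = endpoint∈ x∈ y∈ (interval-adjacent P I nil z≤n)
    ... | no a≢b with interval-distance3 P I (proj₂ (proj₂ (walk-vḠ-vḠ a b))) (proj₁ (proj₂ (walk-vḠ-vḠ a b)))
    ...   | inj₁ refl = x∈
    ...   | inj₂ (inj₁ refl) = y∈
    ...   | inj₂ (inj₂ (inj₁ (az , ℓ , ℓ≤2 , walk))) = from-Ḡ (∈-++ʳ⁻ T x∈) (∈-++ʳ⁻ T y∈) a≢b az walk ℓ≤2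
    ...   | inj₂ (inj₂ (inj₂ ((ℓ , ℓ≤2 , walk) , zb))) =
      from-Ḡ (∈-++ʳ⁻ T y∈) (∈-++ʳ⁻ T x∈) (a≢b ∘ sym) (edge-sym P zb) (walk-reverse P walk) ℓ≤2

  -- Lower bounds: a hull set S contains, for every component, a v̄-vertex of
  -- it; these are distinct for distinct components, so ∣ R ∣ ≤ ∣ S ∣ for a
  -- system of representatives R.
  module _ {R : Subset n} (reps : Representatives Ḡ R) (S : Subset (n + n)) (hull : IsHullSet P S) where

    open Representatives reps

    chosen : Fin n → Fin n
    chosen r = proj₁ (hull-set-meets-component S hull r)

    chosen∈S : ∀ r → vḠ (chosen r) ∈ S
    chosen∈S r = proj₁ (proj₂ (hull-set-meets-component S hull r))

    chosen→r : ∀ r → Reach Ḡ (chosen r) r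
    chosen→r r = proj₂ (proj₂ (hull-set-meets-component S hull r))

    same-component : ∀ {r r′ u} → r ∈ R → r′ ∈ R → Reach Ḡ u r → chosen r′ ≡ u → r ≡ r′
    same-component r∈ r′∈ u→r refl = separate r∈ r′∈ (reach-trans Ḡ (reach-sym Ḡ u→r) (chosen→r _))

    chosen-for : ∀ {r r′ w} → r ∈ R → r′ ∈ R → Reach Ḡ w r → vḠ (chosen r′) ≡ vḠ w → chosen r ≡ w
    chosen-for r∈ r′∈ w→r eq = trans (cong chosen (same-component r∈ r′∈ w→r (vḠ-injective eq))) (vḠ-injective eq)

    chosen-injective : ∀ {r r′} → r ∈ R → r′ ∈ R → vḠ (chosen r) ≡ vḠ (chosen r′) → r ≡ r′
    chosen-injective r∈ r′∈ eq = same-component r∈ r′∈ (chosen→r _) (sym (vḠ-injective eq))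

    hull-set-lower-bound : ∣ R ∣ ≤ ∣ S ∣
    hull-set-lower-bound = injection⇒∣p∣≤∣q∣ (vḠ ∘ chosen) (λ {r} _ → chosen∈S r) chosen-injective

    Unchosen : Set
    Unchosen = Σ (Fin (n + n)) λ e → e ∈ S × (∀ {r} → r ∈ R → vḠ (chosen r) ≢ e)

    -- of two distinct v̄-vertices of S in one component at most one is chosen
    unchosen-of-pair : ∀ {u v} → vḠ u ∈ S → vḠ v ∈ S → u ≢ v → Reach Ḡ u v → Unchosen
    unchosen-of-pair {u} {v} u∈S v∈S u≢v u→v with represent u
    ... | r , r∈ , u→r with chosen r ≟ u
    ...   | yes chosen≡u = vḠ v , v∈S , λ r′∈ eq → u≢v (trans (sym chosen≡u) (chosen-for r∈ r′∈ (reach-trans Ḡ (reach-sym Ḡ u→v) u→r) eq))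
    ...   | no chosen≢u = vḠ u , u∈S , λ r′∈ eq → chosen≢u (chosen-for r∈ r′∈ u→r eq)

    -- If Ḡ has an edge r₁w₁, some vertex of S is unchosen: either S meets the
    -- G-copy, or S contains two v̄-vertices of one component, or else S lies
    -- in the convex set of doubled-convex, which then misses v̄_{r₁} or v̄_{w₁}.
    unchosen : ∀ {r₁ w₁} → Edge Ḡ r₁ w₁ → Unchosen
    unchosen {r₁} {w₁} r₁w₁ with any? (λ i → vG i ∈? S)
    ... | yes (i , i∈S) = vG i , i∈S , λ _ eq → vG≢vḠ (sym eq)
    ... | no S∩G-copy=∅ with any? (λ u → any? (λ v → (vḠ u ∈? S) ×-dec (vḠ v ∈? S) ×-dec ¬? (u ≟ v) ×-dec reachḠ? u v))
    ...   | yes (u , v , u∈S , v∈S , u≢v , u→v) = unchosen-of-pair u∈S v∈S u≢v u→v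
    ...   | no no-pair = ⊥-elim (edge⇒≢ Ḡ r₁w₁ (T-separate (in-T r₁) (in-T w₁) (reach-edge Ḡ r₁w₁)))
      where
      in-S? : ∀ u → Dec (vḠ u ∈ S)
      in-S? u = vḠ u ∈? S
      T : Subset n
      T = ⟦ in-S? ⟧
      T-separate : ∀ {u v} → u ∈ T → v ∈ T → Reach Ḡ u v → u ≡ v
      T-separate {u} {v} u∈ v∈ u→v with u ≟ v
      ... | yes u≡v = u≡v
      ... | no u≢v = ⊥-elim (no-pair (u , v , ∈⟦⟧⁻ in-S? u∈ , ∈⟦⟧⁻ in-S? v∈ , u≢v , u→v))
      S⊆ : S ⊆ T ++ T
      S⊆ {x} x∈S with side x
      ... | inG i = ⊥-elim (S∩G-copy=∅ (i , x∈S))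
      ... | inḠ u = ∈-++ʳ⁺ T (∈⟦⟧⁺ in-S? x∈S)
      in-T : ∀ u → u ∈ T
      in-T u = ∈-++ʳ⁻ T (hull (T ++ T) S⊆ (doubled-convex T T-separate) (vḠ u))

    hull-set-lower-bound-strict : ∀ {r₁ w₁} → Edge Ḡ r₁ w₁ → ∣ R ∣ < ∣ S ∣
    hull-set-lower-bound-strict r₁w₁ with unchosen r₁w₁
    ... | e , e∈S , missed = injection-missing⇒∣p∣<∣q∣ (vḠ ∘ chosen) (λ {r} _ → chosen∈S r) chosen-injective e∈S missed

  meets-all-components : ∀ {R} → Representatives Ḡ R → ∀ K → (∀ {r} → r ∈ R → vḠ r ∈ K) →
    ∀ v → Σ (Fin n) λ u → vḠ u ∈ K × Reach Ḡ u v
  meets-all-components reps K R↦K v with Representatives.represent reps v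
  ... | r , r∈ , v→r = r , R↦K r∈ , reach-sym Ḡ v→r

  Ḡ-copy-hull : ∀ K → Convex P K → (∀ v → vḠ v ∈ K) → ∀ x → x ∈ K
  Ḡ-copy-hull K convex allḠ = everything K convex allG (λ v → v , allḠ v , reach-refl Ḡ)
    where
    allG : ∀ i → vG i ∈ K
    allG i = separated-closure K convex (allḠ i) (allḠ (proj₁ (another-component i))) (proj₂ (another-component i))

  edgeless-hull-set : ∀ {R} → Representatives Ḡ R → (∀ v → Isolated Ḡ v) → IsHullSet P (⊥ ++ R)
  edgeless-hull-set {R} reps isolated K R⊆K convex = Ḡ-copy-hull K convex allḠ
    where
    allḠ : ∀ v → vḠ v ∈ K
    allḠ v with meets-all-components reps K (R⊆K ∘ ∈-++ʳ⁺ ⊥) v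
    ... | u , u∈ , u→v = subst (λ w → vḠ w ∈ K) (sym (isolated-reach Ḡ (isolated u) u→v)) u∈

  -- (k ≥ 2) With two non-trivial components, represented by r₁ ≠ r₂ with
  -- Ḡ-neighbours x of r₁ and y of r₂, adding v_x to the Ḡ-copy of a system
  -- of representatives gives a hull set: v_{r₁} ∈ K as r₁, r₂ are separated,
  -- then v_z ∈ K for z off the component of r₁ (using the edge x r₁),
  -- in particular v_{r₂}, v_y, and finally the rest (using the edge y r₂).
  two-components-hull-set : ∀ {R r₁ r₂ x y} → Representatives Ḡ R → r₁ ∈ R → r₂ ∈ R → r₁ ≢ r₂ →
    Edge Ḡ r₁ x → Edge Ḡ r₂ y → IsHullSet P (⁅ x ⁆ ++ R)
  two-components-hull-set {R} {r₁} {r₂} {x} {y} reps r₁∈ r₂∈ r₁≢r₂ r₁x r₂y K S⊆K convex =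
    everything K convex allG (meets-all-components reps K R↦K)
    where
    R↦K : ∀ {r} → r ∈ R → vḠ r ∈ K
    R↦K = S⊆K ∘ ∈-++ʳ⁺ ⁅ x ⁆
    r₁⇸r₂ : ¬ Reach Ḡ r₁ r₂
    r₁⇸r₂ = r₁≢r₂ ∘ Representatives.separate reps r₁∈ r₂∈
    off-r₁ : ∀ {z} → ¬ Reach Ḡ z r₁ → vG z ∈ K
    off-r₁ = component-edge-closure K convex (S⊆K (∈-++ˡ⁺ R (x∈⁅x⁆ x)))
               (separated-closure K convex (R↦K r₁∈) (R↦K r₂∈) r₁⇸r₂) (edge-sym Ḡ r₁x)
    allG : ∀ z → vG z ∈ K
    allG z with reachḠ? z r₁
    ... | no z⇸r₁ = off-r₁ z⇸r₁
    ... | yes z→r₁ = component-edge-closure K convex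
          (off-r₁ λ y→r₁ → r₁⇸r₂ (reach-trans Ḡ (reach-sym Ḡ y→r₁) (reach-sym Ḡ (reach-edge Ḡ r₂y))))
          (off-r₁ (r₁⇸r₂ ∘ reach-sym Ḡ)) (edge-sym Ḡ r₂y)
          (λ z→r₂ → r₁⇸r₂ (reach-trans Ḡ (reach-sym Ḡ z→r₁) z→r₂))

  -- (k = 1) Ḡ has one non-trivial component, the image of an injection ι;
  -- the other vertices form the set T of isolated vertices of Ḡ.
  module OneComponent {m : ℕ} (ι : Fin m → Fin n) (ι-injective : ∀ {i j} → ι i ≡ ι j → i ≡ j)
    (ι-non-isolated : ∀ i → ¬ Isolated Ḡ (ι i))
    (ι-covers : ∀ v → ¬ Isolated Ḡ v → Σ (Fin m) λ i → ι i ≡ v) where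

    isolated? : ∀ v → Dec (Isolated Ḡ v)
    isolated? v = all? (λ w → ¬? (edge? Ḡ v w))

    T : Subset n
    T = ⟦ isolated? ⟧

    isolated-or-covered : ∀ v → v ∈ T ⊎ Σ (Fin m) λ i → ι i ≡ v
    isolated-or-covered v with isolated? v
    ... | yes iso = inj₁ (∈⟦⟧⁺ isolated? iso)
    ... | no ¬iso = inj₂ (ι-covers v ¬iso)

    G-embedding : InducedEmbedding (induced G ι) P (vG ∘ ι)
    G-embedding = record { injective = ι-injective ∘ vG-injective ; edge⁺ = GG-edge⁺ ; edge⁻ = GG-edge⁻ }

    Ḡ-embedding : InducedEmbedding (induced Ḡ ι) P (vḠ ∘ ι)
    Ḡ-embedding = record { injective = ι-injective ∘ vḠ-injective ; edge⁺ = ḠḠ-edge⁺ ; edge⁻ = ḠḠ-edge⁻ }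

    from-Ḡ₁ : Subset m → Subset (n + n)
    from-Ḡ₁ S₂ = ⊥ ++ (image ι S₂ ∪ T)

    from-Ḡ₁-hull-set : ∀ S₂ → IsHullSet (induced Ḡ ι) S₂ → IsHullSet P (from-Ḡ₁ S₂)
    from-Ḡ₁-hull-set S₂ hull₂ K S⊆K convex = Ḡ-copy-hull K convex allḠ
      where
      S₂↦K : ∀ i → vḠ (ι i) ∈ K
      S₂↦K = hull-transfer (induced-cograph Ḡ ι (complement-cograph G cg)) Ḡ-embedding K convex S₂ hull₂
        (λ {i} i∈ → S⊆K (∈-++ʳ⁺ ⊥ (x∈p∪q⁺ (inj₁ (∈-image ι i∈)))))
      allḠ : ∀ v → vḠ v ∈ K
      allḠ v with isolated-or-covered v
      ... | inj₁ v∈T = S⊆K (∈-++ʳ⁺ ⊥ (x∈p∪q⁺ (inj₂ v∈T)))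
      ... | inj₂ (i , refl) = S₂↦K i

    ∣from-Ḡ₁∣ : ∀ S₂ → ∣ from-Ḡ₁ S₂ ∣ ≤ ∣ S₂ ∣ + ∣ T ∣
    ∣from-Ḡ₁∣ S₂ = begin
      ∣ ⊥ {n} ++ (image ι S₂ ∪ T) ∣   ≡⟨ ∣p++q∣≡∣p∣+∣q∣ (⊥ {n}) _ ⟩
      ∣ ⊥ {n} ∣ + ∣ image ι S₂ ∪ T ∣   ≡⟨ cong (_+ ∣ image ι S₂ ∪ T ∣) (∣⊥∣≡0 n) ⟩
      ∣ image ι S₂ ∪ T ∣               ≤⟨ ∣p∪q∣≤∣p∣+∣q∣ (image ι S₂) T ⟩
      ∣ image ι S₂ ∣ + ∣ T ∣           ≤⟨ +-mono-≤ (∣image∣≤∣p∣ ι S₂) ≤-refl ⟩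
      ∣ S₂ ∣ + ∣ T ∣                   ∎
      where open Data.Nat.Properties.≤-Reasoning

    -- Here v_{ι x₀}
    -- is recovered from v̄_{ι x₀} and a v̄-vertex of another component.
    from-G₁ : Subset m → Fin m → Subset (n + n)
    from-G₁ S₁ x₀ = image ι (S₁ - x₀) ++ (⁅ ι x₀ ⁆ ∪ T)

    from-G₁-hull-set : (∀ i j → Reach Ḡ (ι i) (ι j)) →
      ∀ S₁ → IsHullSet (induced G ι) S₁ → ∀ {x₀} → x₀ ∈ S₁ → IsHullSet P (from-G₁ S₁ x₀)
    from-G₁-hull-set ι-connected S₁ hull₁ {x₀} x₀∈ K S⊆K convex = everything K convex allG meets
      where
      x̄₀∈K : vḠ (ι x₀) ∈ K
      x̄₀∈K = S⊆K (∈-++ʳ⁺ (image ι (S₁ - x₀)) (x∈p∪q⁺ (inj₁ (x∈⁅x⁆ (ι x₀)))))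
      T↦K : ∀ {v} → v ∈ T → vḠ v ∈ K
      T↦K v∈T = S⊆K (∈-++ʳ⁺ (image ι (S₁ - x₀)) (x∈p∪q⁺ (inj₂ v∈T)))
      T⇸x₀ : ∀ {v} → v ∈ T → ¬ Reach Ḡ v (ι x₀)
      T⇸x₀ {v} v∈T v→x₀ = ι-non-isolated x₀ (subst (Isolated Ḡ) (sym (isolated-reach Ḡ v-isolated v→x₀)) v-isolated)
        where
        v-isolated : Isolated Ḡ v
        v-isolated = ∈⟦⟧⁻ isolated? v∈T
      x₀∈K : vG (ι x₀) ∈ K
      x₀∈K with another-component (ι x₀)
      ... | o , x₀⇸o with isolated-or-covered o
      ...   | inj₁ o∈T = separated-closure K convex x̄₀∈K (T↦K o∈T) x₀⇸o
      ...   | inj₂ (j , refl) = ⊥-elim (x₀⇸o (ι-connected x₀ j))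
      S₁↦K : ∀ {i} → i ∈ S₁ → vG (ι i) ∈ K
      S₁↦K {i} i∈ with i ≟ x₀
      ... | yes refl = x₀∈K
      ... | no i≢x₀ = S⊆K (∈-++ˡ⁺ (⁅ ι x₀ ⁆ ∪ T) (∈-image ι (x∈p∧x≢y⇒x∈p-y i∈ i≢x₀)))
      allG : ∀ v → vG v ∈ K
      allG v with isolated-or-covered v
      ... | inj₁ v∈T = separated-closure K convex (T↦K v∈T) x̄₀∈K (T⇸x₀ v∈T)
      ... | inj₂ (i , refl) = hull-transfer (induced-cograph G ι cg) G-embedding K convex S₁ hull₁ S₁↦K i
      meets : ∀ v → Σ (Fin n) λ u → vḠ u ∈ K × Reach Ḡ u v
      meets v with isolated-or-covered v
      ... | inj₁ v∈T = v , T↦K v∈T , reach-refl Ḡ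
      ... | inj₂ (i , refl) = ι x₀ , x̄₀∈K , ι-connected x₀ i

    ∣from-G₁∣ : ∀ S₁ {x₀} → x₀ ∈ S₁ → ∣ from-G₁ S₁ x₀ ∣ ≤ ∣ S₁ ∣ + ∣ T ∣
    ∣from-G₁∣ S₁ {x₀} x₀∈ = begin
      ∣ image ι (S₁ - x₀) ++ (⁅ ι x₀ ⁆ ∪ T) ∣     ≡⟨ ∣p++q∣≡∣p∣+∣q∣ (image ι (S₁ - x₀)) _ ⟩
      ∣ image ι (S₁ - x₀) ∣ + ∣ ⁅ ι x₀ ⁆ ∪ T ∣    ≤⟨ +-mono-≤ (∣image∣≤∣p∣ ι (S₁ - x₀)) (∣p∪q∣≤∣p∣+∣q∣ ⁅ ι x₀ ⁆ T) ⟩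
      ∣ S₁ - x₀ ∣ + (∣ ⁅ ι x₀ ⁆ ∣ + ∣ T ∣)        ≡⟨ cong (λ c → ∣ S₁ - x₀ ∣ + (c + ∣ T ∣)) (∣⁅x⁆∣≡1 (ι x₀)) ⟩
      ∣ S₁ - x₀ ∣ + suc ∣ T ∣                     ≡⟨ +-suc ∣ S₁ - x₀ ∣ ∣ T ∣ ⟩
      suc ∣ S₁ - x₀ ∣ + ∣ T ∣                     ≤⟨ +-mono-≤ (x∈p⇒∣p-x∣<∣p∣ x₀∈) ≤-refl ⟩
      ∣ S₁ ∣ + ∣ T ∣                              ∎
      where open Data.Nat.Properties.≤-Reasoning

module _ {n : ℕ} (H : Graph n) where

  isolated⇒trivial : ∀ {v} → Isolated H v → TrivialAt H v
  isolated⇒trivial iso w = isolated-reach H iso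

  nontrivial⇒¬isolated : ∀ {v} → NonTrivialAt H v → ¬ Isolated H v
  nontrivial⇒¬isolated (w , v→w , w≢v) iso = w≢v (isolated-reach H iso v→w)

  neighbour : ∀ {v} → ¬ Isolated H v → Σ (Fin n) λ w → Edge H v w
  neighbour {v} ¬iso with any? (edge? H v)
  ... | yes found = found
  ... | no no-edge = ⊥-elim (¬iso λ w vw → no-edge (w , vw))

  ¬isolated⇒nontrivial : ∀ {v} → ¬ Isolated H v → NonTrivialAt H v
  ¬isolated⇒nontrivial ¬iso with neighbour ¬iso
  ... | w , vw = w , reach-edge H vw , edge⇒≢ H vw ∘ sym

  module Counted {k t} (nontrivial : NumComponents H (NonTrivialAt H) k) (trivial : NumComponents H (TrivialAt H) t) where

    RN RT R : Subset n
    RN = proj₁ nontrivial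
    RT = proj₁ trivial
    R = RN ∪ RT

    ∣RN∣≡k : ∣ RN ∣ ≡ k
    ∣RN∣≡k = proj₁ (proj₂ nontrivial)

    ∣RT∣≡t : ∣ RT ∣ ≡ t
    ∣RT∣≡t = proj₁ (proj₂ trivial)

    RN-nontrivial : ∀ {r} → r ∈ RN → NonTrivialAt H r
    RN-nontrivial = proj₁ (proj₂ (proj₂ nontrivial)) _

    RT-trivial : ∀ {r} → r ∈ RT → TrivialAt H r
    RT-trivial = proj₁ (proj₂ (proj₂ trivial)) _

    RN-represents : ∀ {v} → NonTrivialAt H v → Σ (Fin n) λ r → r ∈ RN × Reach H v r
    RN-represents = proj₁ (proj₂ (proj₂ (proj₂ nontrivial))) _

    RT-represents : ∀ {v} → TrivialAt H v → Σ (Fin n) λ r → r ∈ RT × Reach H v r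
    RT-represents = proj₁ (proj₂ (proj₂ (proj₂ trivial))) _

    represent : ∀ v → Σ (Fin n) λ r → r ∈ R × Reach H v r
    represent v with any? (edge? H v)
    ... | yes (w , vw) with RN-represents (¬isolated⇒nontrivial (λ iso → iso w vw))
    ...   | r , r∈ , v→r = r , x∈p∪q⁺ (inj₁ r∈) , v→r
    represent v | no no-edge with RT-represents (isolated⇒trivial (λ w vw → no-edge (w , vw)))
    ...   | r , r∈ , v→r = r , x∈p∪q⁺ (inj₂ r∈) , v→r

    mixed-separate : ∀ {r r′} → r ∈ RN → r′ ∈ RT → ¬ Reach H r r′
    mixed-separate r∈ r′∈ r→r′ with RN-nontrivial r∈
    ... | w , r→w , w≢r =
      w≢r (trans (RT-trivial r′∈ w (reach-trans H (reach-sym H r→r′) r→w)) (sym (RT-trivial r′∈ _ (reach-sym H r→r′))))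

    separate : ∀ {r r′} → r ∈ R → r′ ∈ R → Reach H r r′ → r ≡ r′
    separate {r} {r′} r∈ r′∈ r→r′ with x∈p∪q⁻ RN RT r∈ | x∈p∪q⁻ RN RT r′∈
    ... | inj₁ r∈N | inj₁ r′∈N = proj₂ (proj₂ (proj₂ (proj₂ nontrivial))) r r′ r∈N r′∈N r→r′
    ... | inj₂ r∈T | inj₂ r′∈T = proj₂ (proj₂ (proj₂ (proj₂ trivial))) r r′ r∈T r′∈T r→r′
    ... | inj₁ r∈N | inj₂ r′∈T = ⊥-elim (mixed-separate r∈N r′∈T r→r′)
    ... | inj₂ r∈T | inj₁ r′∈N = ⊥-elim (mixed-separate r′∈N r∈T (reach-sym H r→r′))

    representatives : Representatives H R
    representatives = record { represent = represent ; separate = separate }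

    ∣R∣≡k+t : ∣ R ∣ ≡ k + t
    ∣R∣≡k+t = trans (∣p∪q∣≡∣p∣+∣q∣ RN RT (λ r∈N r∈T → mixed-separate r∈N r∈T (reach-refl H))) (cong₂ _+_ ∣RN∣≡k ∣RT∣≡t)

    isolated∈RT : ∀ {v} → Isolated H v → v ∈ RT
    isolated∈RT iso with RT-represents (isolated⇒trivial iso)
    ... | r , r∈ , v→r = subst (_∈ RT) (isolated-reach H iso v→r) r∈

    k≡0⇒edgeless : k ≡ 0 → ∀ v → Isolated H v
    k≡0⇒edgeless k≡0 v w vw with RN-represents (¬isolated⇒nontrivial (λ iso → iso w vw))
    ... | r , r∈ , _ with subst (1 ≤_) (trans ∣RN∣≡k k≡0) (∈⇒1≤∣p∣ r∈)
    ...   | ()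

    1≤k⇒edge : 1 ≤ k → Σ (Fin n) λ r → Σ (Fin n) λ w → Edge H r w
    1≤k⇒edge 1≤k with 1≤∣p∣⇒nonempty RN (subst (1 ≤_) (sym ∣RN∣≡k) 1≤k)
    ... | r , r∈ = r , neighbour (nontrivial⇒¬isolated (RN-nontrivial r∈))

    k≡1⇒one-component : k ≡ 1 → ∀ {u v} → NonTrivialAt H u → NonTrivialAt H v → Reach H u v
    k≡1⇒one-component k≡1 nu nv with RN-represents nu | RN-represents nv
    ... | r , r∈ , u→r | r′ , r′∈ , v→r′ with r ≟ r′
    ...   | yes refl = reach-trans H u→r (reach-sym H v→r′)
    ...   | no r≢r′ with subst (2 ≤_) (trans ∣RN∣≡k k≡1) (distinct⇒2≤∣p∣ r∈ r′∈ r≢r′)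
    ...     | s≤s ()

    2≤k⇒two-components : 2 ≤ k → Σ (Fin n) λ r₁ → Σ (Fin n) λ r₂ → r₁ ∈ R × r₂ ∈ R × r₁ ≢ r₂ ×
      (Σ (Fin n) λ x → Edge H r₁ x) × (Σ (Fin n) λ y → Edge H r₂ y)
    2≤k⇒two-components 2≤k with 2≤∣p∣⇒distinct RN (subst (2 ≤_) (sym ∣RN∣≡k) 2≤k)
    ... | r₁ , r₂ , r₁∈ , r₂∈ , r₁≢r₂ =
      r₁ , r₂ , x∈p∪q⁺ (inj₁ r₁∈) , x∈p∪q⁺ (inj₁ r₂∈) , r₁≢r₂ ,
      neighbour (nontrivial⇒¬isolated (RN-nontrivial r₁∈)) , neighbour (nontrivial⇒¬isolated (RN-nontrivial r₂∈))

module Cases {n : ℕ} (G : Graph n) (2≤n : 2 ≤ n) (connected : Connected G) (cg : Cograph G) {k t : ℕ}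
  (nontrivial : NumComponents (complement G) (NonTrivialAt (complement G)) k)
  (trivial : NumComponents (complement G) (TrivialAt (complement G)) t) where

  open Counted (complement G) nontrivial trivial

  Ḡ-disconnected : ¬ Connected (complement G)
  Ḡ-disconnected = connected-cograph⇒disconnected-complement G 2≤n connected cg

  open HullsOfPrism G cg Ḡ-disconnected

  lower : ∀ S → IsHullSet (prism G) S → k + t ≤ ∣ S ∣
  lower S hull = subst (_≤ ∣ S ∣) ∣R∣≡k+t (hull-set-lower-bound representatives S hull)

  lower-strict : 1 ≤ k → ∀ S → IsHullSet (prism G) S → suc (k + t) ≤ ∣ S ∣
  lower-strict 1≤k S hull with 1≤k⇒edge 1≤k
  ... | _ , _ , rw = subst (_< ∣ S ∣) ∣R∣≡k+t (hull-set-lower-bound-strict representatives S hull rw)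

  hull-number-k≡0 : k ≡ 0 → HullNumber (prism G) t
  hull-number-k≡0 refl =
    (⊥ ++ R , edgeless-hull-set representatives (k≡0⇒edgeless refl) ,
      trans (∣p++q∣≡∣p∣+∣q∣ (⊥ {n}) R) (trans (cong (_+ ∣ R ∣) (∣⊥∣≡0 n)) ∣R∣≡k+t)) ,
    lower

  hull-number-2≤k : 2 ≤ k → HullNumber (prism G) (k + t + 1)
  hull-number-2≤k 2≤k with 2≤k⇒two-components 2≤k
  ... | r₁ , r₂ , r₁∈ , r₂∈ , r₁≢r₂ , (x , r₁x) , (y , r₂y) =
    (⁅ x ⁆ ++ R , two-components-hull-set representatives r₁∈ r₂∈ r₁≢r₂ r₁x r₂y ,
      trans (∣p++q∣≡∣p∣+∣q∣ ⁅ x ⁆ R) (trans (cong₂ _+_ (∣⁅x⁆∣≡1 x) ∣R∣≡k+t) (+-comm 1 (k + t)))) ,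
    λ S hull → subst (_≤ ∣ S ∣) (+-comm 1 (k + t)) (lower-strict (≤-trans (s≤s z≤n) 2≤k) S hull)

  bounds-k≡1 : k ≡ 1 → ∀ m (ι : Fin m → Fin n) → Injective _≡_ _≡_ ι →
    (∀ i → NonTrivialAt (complement G) (ι i)) →
    (∀ v → NonTrivialAt (complement G) v → Σ (Fin m) λ i → ι i ≡ v) →
    ∀ h h₁ h₂ → HullNumber (prism G) h → HullNumber (induced G ι) h₁ → HullNumber (induced (complement G) ι) h₂ →
    t + 2 ≤ h × h ≤ (h₁ ⊓ h₂) + t
  bounds-k≡1 refl m ι ι-injective ι-nontrivial ι-onto h h₁ h₂ ((S , hull , refl) , minimal) ((S₁ , hull₁ , refl) , _) ((S₂ , hull₂ , refl) , _) =
    subst (_≤ ∣ S ∣) (+-comm 2 t) (lower-strict ≤-refl S hull) ,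
    subst (∣ S ∣ ≤_) (sym (+-distribʳ-⊓ t ∣ S₁ ∣ ∣ S₂ ∣)) (⊓-glb via-G₁ via-Ḡ₁)
    where
    open OneComponent ι ι-injective (nontrivial⇒¬isolated (complement G) ∘ ι-nontrivial)
      (λ v → ι-onto v ∘ ¬isolated⇒nontrivial (complement G))
    ∣T∣≤t : ∣ T ∣ ≤ t
    ∣T∣≤t = subst (∣ T ∣ ≤_) ∣RT∣≡t (p⊆q⇒∣p∣≤∣q∣ (isolated∈RT ∘ ∈⟦⟧⁻ isolated?))
    via-Ḡ₁ : ∣ S ∣ ≤ ∣ S₂ ∣ + t
    via-Ḡ₁ = ≤-trans (minimal _ (from-Ḡ₁-hull-set S₂ hull₂)) (≤-trans (∣from-Ḡ₁∣ S₂) (+-mono-≤ ≤-refl ∣T∣≤t))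
    -- G₁ has a vertex (a preimage of a non-trivial vertex), so S₁ has an element x₀
    via-G₁ : ∣ S ∣ ≤ ∣ S₁ ∣ + t
    via-G₁ with 1≤k⇒edge ≤-refl
    ... | r , w , rw with hull-set-nonempty (induced G ι) hull₁ (proj₁ (ι-onto r (¬isolated⇒nontrivial (complement G) (λ iso → iso w rw))))
    ...   | x₀ , x₀∈ = ≤-trans (minimal _ (from-G₁-hull-set ι-connected S₁ hull₁ x₀∈)) (≤-trans (∣from-G₁∣ S₁ x₀∈) (+-mono-≤ ≤-refl ∣T∣≤t))
      where
      ι-connected : ∀ i j → Reach (complement G) (ι i) (ι j)
      ι-connected i j = k≡1⇒one-component refl (ι-nontrivial i) (ι-nontrivial j)

theorem7 : ∀ {n} (G : Graph n) → 2 ≤ n → Connected G → Cograph G →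
    ∀ k t →
    NumComponents (complement G) (NonTrivialAt (complement G)) k →
    NumComponents (complement G) (TrivialAt (complement G)) t →
    (k ≡ 0 → HullNumber (prism G) t) ×
    (k ≡ 1 →
      ∀ m (ι : Fin m → Fin n) → Injective _≡_ _≡_ ι →
      (∀ i → NonTrivialAt (complement G) (ι i)) →
      (∀ v → NonTrivialAt (complement G) v → Σ (Fin m) λ i → ι i ≡ v) →
      ∀ h h₁ h₂ → HullNumber (prism G) h →
      HullNumber (induced G ι) h₁ →
      HullNumber (induced (complement G) ι) h₂ →
      t + 2 ≤ h × h ≤ (h₁ ⊓ h₂) + t) ×
    (2 ≤ k → HullNumber (prism G) (k + t + 1))
theorem7 G 2≤n connected cg k t nontrivial trivial = hull-number-k≡0 , bounds-k≡1 , hull-number-2≤k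
  where open Cases G 2≤n connected cg nontrivial trivial
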